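{- Let $\mathcal{C}$ be an scwf with an $\mathrm{N}_1$-structure and a $\times$-structure, and let $\Gamma\in\mathcal{C}_0$. Then the category $\mathrm{Ty}(\Gamma)$ of types and terms in context $\Gamma$ is a cartesian category with structure, where the chosen terminal object is $\mathrm{N}_1$, and for $A,B\in\mathrm{Ty}$ the chosen product is $A\times B$ with projections $\mathrm{fst}(\mathrm{q}_{\Gamma,A\times B})\in\mathrm{Ty}(\Gamma)(A\times B,A)$ and $\mathrm{snd}(\mathrm{q}_{\Gamma,A\times B})\in\mathrm{Ty}(\Gamma)(A\times B,B)$.
   Context: A simply typed cwf (scwf) consists of a category $\mathcal{C}$ with a chosen terminal object $1$; a set $\mathrm{Ty}$; for each $A\in\mathrm{Ty}$ a presheaf $\mathrm{Tm}(-,A)$ on $\mathcal{C}$ (action written $a[\gamma]$); and for each $\Gamma$, $A$ a chosen $\Gamma\cdot A$, $\mathrm{p}_{\Gamma,A}:\Gamma\cdot A\to\Gamma$, $\mathrm{q}_{\Gamma,A}\in\mathrm{Tm}(\Gamma\cdot A,A)$ such that for all $\gamma:\Delta\to\Gamma$, $a\in\mathrm{Tm}(\Delta,A)$ there is a unique $\langle\gamma,a\rangle:\Delta\to\Gamma\cdot A$ with $\mathrm{p}\circ\langle\gamma,a\rangle=\gamma$, $\mathrm{q}[\langle\gamma,a\rangle]=a$. An $\mathrm{N}_1$-structure is a type $\mathrm{N}_1$ and for each $\Gamma$ a term $0_1\in\mathrm{Tm}(\Gamma,\mathrm{N}_1)$ equal to every element of $\mathrm{Tm}(\Gamma,\mathrm{N}_1)$.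 A $\times$-structure gives for all $A,B$ a type $A\times B$ and, in each context $\Gamma$, operations $\mathrm{fst}:\mathrm{Tm}(\Gamma,A\times B)\to\mathrm{Tm}(\Gamma,A)$, $\mathrm{snd}:\mathrm{Tm}(\Gamma,A\times B)\to\mathrm{Tm}(\Gamma,B)$, $\langle-,-\rangle:\mathrm{Tm}(\Gamma,A)\times\mathrm{Tm}(\Gamma,B)\to\mathrm{Tm}(\Gamma,A\times B)$ with $\mathrm{fst}\langle a,b\rangle=a$, $\mathrm{snd}\langle a,b\rangle=b$, $\langle\mathrm{fst}(c),\mathrm{snd}(c)\rangle=c$ and $\langle a,b\rangle[\gamma]=\langle a[\gamma],b[\gamma]\rangle$. The category $\mathrm{Ty}(\Gamma)$ has as objects the elements of $\mathrm{Ty}$, as morphisms $A\to B$ the terms $b\in\mathrm{Tm}(\Gamma\cdot A,B)$, composition of $b\in\mathrm{Tm}(\Gamma\cdot A,B)$ and $c\in\mathrm{Tm}(\Gamma\cdot B,C)$ given by $c\circ b=c[\langle\mathrm{p}_{\Gamma,A},b\rangle]$, and identity $\mathrm{q}_{\Gamma,A}$. A cartesian category with structure is a category with a chosen terminal object and, for all objects $A,B$, a chosen product object with chosen projections satisfying the universal property of the product. -}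

module Defs where

open import Level using (Level; _⊔_; suc)
open import Data.Product using (Σ; _×_; _,_)
open import Relation.Binary.PropositionalEquality using (_≡_)

-- Simply typed categories with families (scwf), equalities are
-- propositional equality (the paper's sets of morphisms / terms).

record SCWF (o h t : Level) : Set (suc (o ⊔ h ⊔ t)) where
  infixr 9 _∘_
  infixl 8 _[_]
  infixl 7 _·_
  field
    Ctx   : Set o
    Sub   : Ctx → Ctx → Set h          -- Sub Δ Γ = C(Δ , Γ)
    _∘_   : ∀ {Θ Δ Γ} → Sub Δ Γ → Sub Θ Δ → Sub Θ Γ
    id    : ∀ {Γ} → Sub Γ Γ
    idˡ   : ∀ {Δ Γ} (γ : Sub Δ Γ) → id ∘ γ ≡ γ
    idʳ   : ∀ {Δ Γ} (γ : Sub Δ Γ) → γ ∘ id ≡ γ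
    assoc : ∀ {Ξ Θ Δ Γ} (γ : Sub Δ Γ) (δ : Sub Θ Δ) (θ : Sub Ξ Θ) →
            (γ ∘ δ) ∘ θ ≡ γ ∘ (δ ∘ θ)
    ⋄     : Ctx
    ε     : ∀ {Γ} → Sub Γ ⋄
    ε-η   : ∀ {Γ} (γ : Sub Γ ⋄) → γ ≡ ε
    Ty    : Set t
    Tm    : Ctx → Ty → Set h
    _[_]  : ∀ {Δ Γ A} → Tm Γ A → Sub Δ Γ → Tm Δ A
    [id]  : ∀ {Γ A} (a : Tm Γ A) → a [ id ] ≡ a
    [∘]   : ∀ {Θ Δ Γ A} (a : Tm Γ A) (γ : Sub Δ Γ) (δ : Sub Θ Δ) →
            a [ γ ∘ δ ] ≡ a [ γ ] [ δ ]
    _·_   : Ctx → Ty → Ctx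
    p     : ∀ {Γ A} → Sub (Γ · A) Γ
    q     : ∀ {Γ A} → Tm (Γ · A) A
    ⟨_,_⟩ : ∀ {Δ Γ A} → Sub Δ Γ → Tm Δ A → Sub Δ (Γ · A)
    p∘⟨⟩  : ∀ {Δ Γ A} (γ : Sub Δ Γ) (a : Tm Δ A) → p ∘ ⟨ γ , a ⟩ ≡ γ
    q[⟨⟩] : ∀ {Δ Γ A} (γ : Sub Δ Γ) (a : Tm Δ A) → q [ ⟨ γ , a ⟩ ] ≡ a
    ⟨⟩-unique : ∀ {Δ Γ A} (γ : Sub Δ Γ) (a : Tm Δ A) (θ : Sub Δ (Γ · A)) →
                p ∘ θ ≡ γ → q [ θ ] ≡ a → θ ≡ ⟨ γ , a ⟩

record N1-Structure {o h t} (C : SCWF o h t) : Set (o ⊔ h ⊔ t) where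
  open SCWF C
  field
    N₁   : Ty
    0₁   : ∀ {Γ} → Tm Γ N₁
    N₁-η : ∀ {Γ} (a : Tm Γ N₁) → a ≡ 0₁

record ×-Structure {o h t} (C : SCWF o h t) : Set (o ⊔ h ⊔ t) where
  open SCWF C
  infixr 6 _⊗_
  field
    _⊗_     : Ty → Ty → Ty
    fst     : ∀ {Γ A B} → Tm Γ (A ⊗ B) → Tm Γ A
    snd     : ∀ {Γ A B} → Tm Γ (A ⊗ B) → Tm Γ B
    pair    : ∀ {Γ A B} → Tm Γ A → Tm Γ B → Tm Γ (A ⊗ B)
    fst-β   : ∀ {Γ A B} (a : Tm Γ A) (b : Tm Γ B) → fst (pair a b) ≡ a
    snd-β   : ∀ {Γ A B} (a : Tm Γ A) (b : Tm Γ B) → snd (pair a b) ≡ b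
    pair-η  : ∀ {Γ A B} (c : Tm Γ (A ⊗ B)) → pair (fst c) (snd c) ≡ c
    pair-[] : ∀ {Δ Γ A B} (a : Tm Γ A) (b : Tm Γ B) (γ : Sub Δ Γ) →
              pair a b [ γ ] ≡ pair (a [ γ ]) (b [ γ ])

module _ {o ℓ : Level} (Obj : Set o) (Hom : Obj → Obj → Set ℓ)
         (_∘_ : ∀ {X Y Z} → Hom Y Z → Hom X Y → Hom X Z)
         (id : ∀ {X} → Hom X X) where

  record IsCategory : Set (o ⊔ ℓ) where
    field
      idˡ   : ∀ {X Y} (f : Hom X Y) → id ∘ f ≡ f
      idʳ   : ∀ {X Y} (f : Hom X Y) → f ∘ id ≡ f
      assoc : ∀ {W X Y Z} (h : Hom Y Z) (g : Hom X Y) (f : Hom W X) →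
              (h ∘ g) ∘ f ≡ h ∘ (g ∘ f)

  IsTerminal : Obj → Set (o ⊔ ℓ)
  IsTerminal T = ∀ X → Σ (Hom X T) λ f → ∀ (g : Hom X T) → g ≡ f

  IsProduct : (A B P : Obj) → Hom P A → Hom P B → Set (o ⊔ ℓ)
  IsProduct A B P π₁ π₂ =
    ∀ X (f : Hom X A) (g : Hom X B) →
      Σ (Hom X P) λ h → ((π₁ ∘ h ≡ f) × (π₂ ∘ h ≡ g)) ×
        (∀ (h' : Hom X P) → π₁ ∘ h' ≡ f → π₂ ∘ h' ≡ g → h' ≡ h)

  IsCartesianWithStructure :
    (T : Obj) (prod : Obj → Obj → Obj)
    (π₁ : ∀ A B → Hom (prod A B) A) (π₂ : ∀ A B → Hom (prod A B) B) →
    Set (o ⊔ ℓ)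
  IsCartesianWithStructure T prod π₁ π₂ =
    IsCategory × IsTerminal T ×
    (∀ A B → IsProduct A B (prod A B) (π₁ A B) (π₂ A B))

module TyCat {o h t} (C : SCWF o h t) (Γ : SCWF.Ctx C) where
  open SCWF C

  Hom : Ty → Ty → Set h
  Hom A B = Tm (Γ · A) B

  comp : ∀ {A B D} → Hom B D → Hom A B → Hom A D
  comp c b = c [ ⟨ p , b ⟩ ]

  ident : ∀ {A} → Hom A A
  ident = q

module Submission where

-- A morphism X → Y of Ty(Γ) is a term of type Y in context Γ · X, and
-- precomposition with k is substitution along ⟨ p , k ⟩. The category laws
-- are therefore the laws of substitution and comprehension. Since fst and
-- snd commute with substitution, composing k with the projections fst q and
-- snd q gives fst k and snd k; the universal property of A ⊗ B is then just
-- β and η for pairs, and N₁ is terminal by its η-law.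

open import Defs
open import Data.Product using (_,_)
open import Relation.Binary.PropositionalEquality
  using (_≡_; sym; trans; cong; cong₂; module ≡-Reasoning)

module SCWF-Properties {o h t} (C : SCWF o h t) where
  open SCWF C

  ⟨,⟩-∘ : ∀ {Θ Δ Ξ A} (γ : Sub Δ Ξ) (a : Tm Δ A) (δ : Sub Θ Δ) →
          ⟨ γ , a ⟩ ∘ δ ≡ ⟨ γ ∘ δ , a [ δ ] ⟩
  ⟨,⟩-∘ γ a δ = ⟨⟩-unique _ _ _
    (trans (sym (assoc p ⟨ γ , a ⟩ δ)) (cong (_∘ δ) (p∘⟨⟩ γ a)))
    (trans ([∘] q ⟨ γ , a ⟩ δ) (cong (_[ δ ]) (q[⟨⟩] γ a)))

  ⟨p,q⟩≡id : ∀ {Δ A} → ⟨ p {Δ} {A} , q ⟩ ≡ id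
  ⟨p,q⟩≡id = sym (⟨⟩-unique _ _ _ (idʳ p) ([id] q))

module ×-Properties {o h t} (C : SCWF o h t) (P : ×-Structure C) where
  open SCWF C
  open ×-Structure P
  open ≡-Reasoning

  fst-[] : ∀ {Δ Ξ A B} (c : Tm Ξ (A ⊗ B)) (γ : Sub Δ Ξ) → fst (c [ γ ]) ≡ fst c [ γ ]
  fst-[] c γ = begin
    fst (c [ γ ])                          ≡⟨ cong (λ x → fst (x [ γ ])) (sym (pair-η c)) ⟩
    fst (pair (fst c) (snd c) [ γ ])       ≡⟨ cong fst (pair-[] _ _ γ) ⟩
    fst (pair (fst c [ γ ]) (snd c [ γ ])) ≡⟨ fst-β _ _ ⟩
    fst c [ γ ]                            ∎

  snd-[] : ∀ {Δ Ξ A B} (c : Tm Ξ (A ⊗ B)) (γ : Sub Δ Ξ) → snd (c [ γ ]) ≡ snd c [ γ ]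
  snd-[] c γ = begin
    snd (c [ γ ])                          ≡⟨ cong (λ x → snd (x [ γ ])) (sym (pair-η c)) ⟩
    snd (pair (fst c) (snd c) [ γ ])       ≡⟨ cong snd (pair-[] _ _ γ) ⟩
    snd (pair (fst c [ γ ]) (snd c [ γ ])) ≡⟨ snd-β _ _ ⟩
    snd c [ γ ]                            ∎

module TyCat-Properties {o h t} (C : SCWF o h t) (Γ : SCWF.Ctx C) where
  open SCWF C
  open TyCat C Γ
  open SCWF-Properties C
  open ≡-Reasoning

  TyCat-isCategory : IsCategory Ty Hom comp ident
  TyCat-isCategory = record
    { idˡ   = q[⟨⟩] p
    ; idʳ   = λ f → trans (cong (f [_]) ⟨p,q⟩≡id) ([id] f)
    ; assoc = λ k g f → begin
        k [ ⟨ p , g ⟩ ] [ ⟨ p , f ⟩ ]              ≡⟨ sym ([∘] k _ _) ⟩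
        k [ ⟨ p , g ⟩ ∘ ⟨ p , f ⟩ ]                ≡⟨ cong (k [_]) (⟨,⟩-∘ p g ⟨ p , f ⟩) ⟩
        k [ ⟨ p ∘ ⟨ p , f ⟩ , g [ ⟨ p , f ⟩ ] ⟩ ]  ≡⟨ cong (λ s → k [ ⟨ s , g [ ⟨ p , f ⟩ ] ⟩ ]) (p∘⟨⟩ p f) ⟩
        k [ ⟨ p , g [ ⟨ p , f ⟩ ] ⟩ ]              ∎
    }

  N₁-isTerminal : (N : N1-Structure C) → IsTerminal Ty Hom comp ident (N1-Structure.N₁ N)
  N₁-isTerminal N X = 0₁ , N₁-η
    where open N1-Structure N

  module _ (P : ×-Structure C) where
    open ×-Structure P
    open ×-Properties C P

    comp-fst-q : ∀ {A B X} (k : Hom X (A ⊗ B)) → comp (fst q) k ≡ fst k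
    comp-fst-q k = trans (sym (fst-[] q ⟨ p , k ⟩)) (cong fst (q[⟨⟩] p k))

    comp-snd-q : ∀ {A B X} (k : Hom X (A ⊗ B)) → comp (snd q) k ≡ snd k
    comp-snd-q k = trans (sym (snd-[] q ⟨ p , k ⟩)) (cong snd (q[⟨⟩] p k))

    ⊗-isProduct : ∀ A B → IsProduct Ty Hom comp ident A B (A ⊗ B) (fst q) (snd q)
    ⊗-isProduct A B X f g =
        pair f g
      , (trans (comp-fst-q _) (fst-β f g) , trans (comp-snd-q _) (snd-β f g))
      , λ k k₁≡f k₂≡g → trans (sym (pair-η k))
          (cong₂ pair (trans (sym (comp-fst-q k)) k₁≡f) (trans (sym (comp-snd-q k)) k₂≡g))

lemma1 : ∀ {o h t} (C : SCWF o h t) (N : N1-Structure C) (P : ×-Structure C) (Γ : SCWF.Ctx C) →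
    IsCartesianWithStructure (SCWF.Ty C) (TyCat.Hom C Γ) (TyCat.comp C Γ) (TyCat.ident C Γ)
    (N1-Structure.N₁ N)
    (×-Structure._⊗_ P)
    (λ A B → ×-Structure.fst P (SCWF.q C))
    (λ A B → ×-Structure.snd P (SCWF.q C))
lemma1 C N P Γ = TyCat-isCategory , N₁-isTerminal N , ⊗-isProduct P
  where open TyCat-Properties C Γ
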